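{- Let \( G \) be a connected graph on vertex set \( V \) and let \( H \) be a group of automorphisms of \( G \). If a nonempty \( \Sigma \subseteq V \) splits all edges of \( G \) and of \( G_2 \) with respect to \( H \), then the pointwise stabilizer \( H_\Sigma \) is trivial.
   Context: \( G_2 \) is the distance-2 graph of \( G \): \( \{x,y\} \) is an edge iff \( d(x,y)=2 \) in \( G \). For a permutation group \( H \) on \( V \) and \( \Sigma\subseteq V \), \( H_\Sigma \) denotes the pointwise stabilizer of \( \Sigma \). A set \( \Sigma \) splits an edge \( e \) with respect to \( H \) if the two endpoints of \( e \) lie in different \( H_\Sigma \)-orbits on \( V \). -}

module Defs where

open import Level using (0ℓ)
open import Data.Nat using (ℕ; zero; suc)
open import Data.Fin using (Fin)
open import Data.Product using (Σ; ∃; _×_; _,_)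
open import Relation.Nullary using (¬_)
open import Relation.Binary using (Decidable)
open import Relation.Binary.PropositionalEquality using (_≡_)
open import Function.Bundles using (_↔_; Inverse)
open import Function.Construct.Identity using (↔-id)
open import Function.Construct.Composition using (_↔-∘_)
open import Function.Construct.Symmetry using (↔-sym)

record Graph (n : ℕ) : Set₁ where
  field
    Adj     : Fin n → Fin n → Set
    adj?    : Decidable Adj
    sym     : ∀ {x y} → Adj x y → Adj y x
    irrefl  : ∀ {x} → ¬ Adj x x
open Graph public

data Walk {n : ℕ} (G : Graph n) : ℕ → Fin n → Fin n → Set where
  here : ∀ {x} → Walk G zero x x
  step : ∀ {k x y z} → Adj G x y → Walk G k y z → Walk G (suc k) x z

Connected : ∀ {n} → Graph n → Set
Connected {n} G = (x y : Fin n) → ∃ λ k → Walk G k x y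

Dist2 : ∀ {n} → Graph n → Fin n → Fin n → Set
Dist2 G x y = Walk G 2 x y × ¬ Walk G 0 x y × ¬ Walk G 1 x y

Perm : ℕ → Set
Perm n = Fin n ↔ Fin n

app : ∀ {n} → Perm n → Fin n → Fin n
app p = Inverse.to p

IsAut : ∀ {n} → Graph n → Perm n → Set
IsAut G p = ∀ x y → (Adj G x y → Adj G (app p x) (app p y))
                  × (Adj G (app p x) (app p y) → Adj G x y)

record IsAutGroup {n : ℕ} (G : Graph n) (H : Perm n → Set) : Set where
  field
    auts   : ∀ p → H p → IsAut G p
    has-id : H (↔-id (Fin n))
    closed : ∀ p q → H p → H q → H (p ↔-∘ q)
    inv    : ∀ p → H p → H (↔-sym p)

Stab : ∀ {n} → (Perm n → Set) → (Fin n → Set) → Perm n → Set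
Stab H S p = H p × (∀ v → S v → app p v ≡ v)

SameOrbit : ∀ {n} → (Perm n → Set) → Fin n → Fin n → Set
SameOrbit K x y = ∃ λ p → K p × app p x ≡ y

Splits : ∀ {n} → (Perm n → Set) → (Fin n → Set) → Fin n → Fin n → Set
Splits H S x y = ¬ SameOrbit (Stab H S) x y

-- An element p of H_Σ fixes some vertex of Σ. If p fixes x and y is a
-- neighbour of x, then y and p y are both neighbours of x, so they are
-- equal, adjacent or at distance 2; they lie in one H_Σ-orbit, so only the
-- first case survives the splitting hypotheses. Hence the fixed points of p
-- are closed under adjacency, and connectivity spreads them over V.
module Submission where

open import Defs
open import Data.Nat using (ℕ)
open import Data.Fin using (Fin)
open import Data.Fin.Properties using (_≟_)
open import Data.Product using (∃; _,_; proj₁; proj₂)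
open import Data.Sum using (_⊎_; inj₁; inj₂)
open import Relation.Nullary using (yes; no; ¬_)
open import Data.Empty using (⊥-elim)
open import Relation.Binary.PropositionalEquality using (_≡_; _≢_; refl; subst)
  renaming (sym to ≡-sym)

module _ {n : ℕ} (G : Graph n) where

  ¬Walk₀ : ∀ {x y} → x ≢ y → ¬ Walk G 0 x y
  ¬Walk₀ x≢y here = x≢y refl

  ¬Walk₁ : ∀ {x y} → ¬ Adj G x y → ¬ Walk G 1 x y
  ¬Walk₁ ¬xy (step xy here) = ¬xy xy

  common-neighbour⇒≡⊎Adj⊎Dist2 : ∀ {x y z} → Adj G z x → Adj G z y →
                                  x ≡ y ⊎ Adj G x y ⊎ Dist2 G x y
  common-neighbour⇒≡⊎Adj⊎Dist2 {x} {y} zx zy with x ≟ y | adj? G x y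
  ... | yes x≡y | _      = inj₁ x≡y
  ... | no  _   | yes xy = inj₂ (inj₁ xy)
  ... | no  x≢y | no ¬xy =
    inj₂ (inj₂ (step (sym G zx) (step zy here) , ¬Walk₀ x≢y , ¬Walk₁ ¬xy))

  Walk-transport : (P : Fin n → Set) → (∀ {x y} → Adj G x y → P x → P y) →
                ∀ {k x y} → Walk G k x y → P x → P y
  Walk-transport P closed here         Px = Px
  Walk-transport P closed (step xy w) Px = Walk-transport P closed w (closed xy Px)

  aut-maps-neighbour-of-fixed-point : ∀ {p} → IsAut G p → ∀ {x y} → app p x ≡ x →
                    Adj G x y → Adj G x (app p y)
  aut-maps-neighbour-of-fixed-point {p} aut {x} {y} px≡x xy =
    subst (λ z → Adj G z (app p y)) px≡x (proj₁ (aut x y) xy)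

module _ {n : ℕ} {G : Graph n} {H : Perm n → Set} {S : Fin n → Set}
         (autGroup : IsAutGroup G H)
         (splits-edges : ∀ x y → Adj G x y → Splits H S x y)
         (splits-dist2 : ∀ x y → Dist2 G x y → Splits H S x y)
         {p : Perm n} (p∈H_Σ : Stab H S p) where

  same-orbit : ∀ y → SameOrbit (Stab H S) y (app p y)
  same-orbit y = p , p∈H_Σ , refl

  stabiliser-aut-maps-neighbour-of-fixed-points : ∀ {x y} → Adj G x y →
                                app p x ≡ x → app p y ≡ y
  stabiliser-aut-maps-neighbour-of-fixed-points {x} {y} xy px≡x
    with common-neighbour⇒≡⊎Adj⊎Dist2 G xy
           (aut-maps-neighbour-of-fixed-point G {p} (IsAutGroup.auts autGroup p (proj₁ p∈H_Σ)) px≡x xy)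
  ... | inj₁ y≡py         = ≡-sym y≡py
  ... | inj₂ (inj₁ adj)   = ⊥-elim (splits-edges y (app p y) adj (same-orbit y))
  ... | inj₂ (inj₂ dist2) = ⊥-elim (splits-dist2 y (app p y) dist2 (same-orbit y))

lemma4p4 : (n : ℕ) (G : Graph n) (H : Perm n → Set) (S : Fin n → Set) →
    Connected G → IsAutGroup G H → (∃ λ v → S v) →
    (∀ x y → Adj G x y → Splits H S x y) →
    (∀ x y → Dist2 G x y → Splits H S x y) →
    ∀ p → Stab H S p → ∀ v → app p v ≡ v
lemma4p4 n G H S connected autGroup (s , s∈Σ) splits-edges splits-dist2 p p∈H_Σ v =
  Walk-transport G (λ x → app p x ≡ x)
    (stabiliser-aut-maps-neighbour-of-fixed-points autGroup splits-edges splits-dist2 p∈H_Σ)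
    (proj₂ (connected s v)) (proj₂ p∈H_Σ s s∈Σ)
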